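{- Let $n,h\ge2$. There exists $p\in\mathcal{P}$ such that $D_{\mu(p)}(p)\ne N$ and $D_{\mu(p)}(p)\cap D_{\mu(p^r)}(p^r)\ne\varnothing$ if and only if $(h,n)\notin T_3$, where $T_3=\{(h,n): n=2\}\cup\{(3,3)\}$.
   Context: $N=\{1,\dots,n\}$, $H=\{1,\dots,h\}$, $\mathcal{P}=\mathcal{L}(N)^h$ the set of profiles of linear orders on $N$; $x>_{p_i}y$ means individual $i$ ranks $x$ above $y$; $p^r$ is the profile in which every individual's order is reversed. For integers $\mu$ with $h/2<\mu\le h$, $D_\mu(p)=\{x\in N:\forall y\in N,\ |\{i: y>_{p_i}x\}|<\mu\}$, and $\mu(p)=\min\{\mu\in\mathbb{N}\cap(h/2,h]: D_\mu(p)\ne\varnothing\}$ (well defined). -}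

module Defs where

open import Data.Nat using (ℕ; zero; suc; _<_; _≤_; _≤?_; _<?_; _+_; _*_)
open import Data.Nat.DivMod using (_/_)
open import Data.Fin using (Fin)
open import Data.Fin.Properties using (any?; all?)
open import Data.List using (List; length; filter)
open import Data.List using (upTo)
open import Data.Fin using () renaming (toℕ to toℕ)
open import Data.Product using (Σ; _×_; _,_; ∃)
open import Function using (flip)
open import Level using (0ℓ)
open import Relation.Binary.Core using (Rel)
open import Relation.Binary.Structures using (IsStrictTotalOrder; IsStrictPartialOrder)
open import Relation.Binary.Definitions using (Tri; tri<; tri≈; tri>)
open import Relation.Binary.PropositionalEquality
  using (_≡_; refl; sym; resp₂) renaming (isEquivalence to ≡-isEquivalence)
open import Relation.Nullary using (Dec; yes; no; ¬_)
import Data.Fin as F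

-- A (strict) linear order on the alternatives N = Fin n:
-- x ≻ y means "x is ranked above y".
record LinearOrder (n : ℕ) : Set₁ where
  field
    _≻_      : Rel (Fin n) 0ℓ
    isLinear : IsStrictTotalOrder _≡_ _≻_
  open IsStrictTotalOrder isLinear public using (_<?_)

reverseOrder : ∀ {n} → LinearOrder n → LinearOrder n
reverseOrder {n} L = record
  { _≻_ = flip _≻_
  ; isLinear = record
    { isStrictPartialOrder = record
      { isEquivalence = ≡-isEquivalence
      ; irrefl = λ eq → irrefl (sym eq)
      ; trans = λ a b → trans b a
      ; <-resp-≈ = resp₂ (flip _≻_)
      }
    ; compare = cmp
    }
  }
  where
  open LinearOrder L
  open IsStrictTotalOrder isLinear using (irrefl; trans; compare)
  cmp : ∀ x y → Tri (flip _≻_ x y) (x ≡ y) (flip _≻_ y x)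
  cmp x y with compare x y
  ... | tri< a b c = tri> c b a
  ... | tri≈ a b c = tri≈ c b a
  ... | tri> a b c = tri< c b a

-- Profiles: P = L(N)^h, one linear order per individual i ∈ H = Fin h.
Profile : ℕ → ℕ → Set₁
Profile n h = Fin h → LinearOrder n

rev : ∀ {n h} → Profile n h → Profile n h
rev p i = reverseOrder (p i)

Above : ∀ {n h} → Profile n h → Fin h → Fin n → Fin n → Set
Above p i x y = LinearOrder._≻_ (p i) x y

above? : ∀ {n h} (p : Profile n h) i x y → Dec (Above p i x y)
above? p i x y = LinearOrder._<?_ (p i) x y

support : ∀ {n h} → Profile n h → Fin n → Fin n → ℕ
support {h = h} p y x = length (filter (λ i → above? p i y x) (Data.List.tabulate {n = h} (λ i → i)))
  where import Data.List

InD : ∀ {n h} → ℕ → Profile n h → Fin n → Set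
InD μ p x = ∀ y → support p y x < μ

InD? : ∀ {n h} μ (p : Profile n h) x → Dec (InD μ p x)
InD? μ p x = all? (λ y → support p y x <? μ)

nonempty? : ∀ {n h} μ (p : Profile n h) → Dec (∃ λ x → InD μ p x)
nonempty? μ p = any? (InD? μ p)

searchMu : ∀ {n h} → Profile n h → ℕ → ℕ → ℕ
searchMu p m zero = m
searchMu p m (suc k) with nonempty? m p
... | yes _ = m
... | no _  = searchMu p (suc m) k

-- μ(p) = min { μ ∈ ℕ ∩ (h/2, h] : D_μ(p) ≠ ∅ }.
-- The integers in (h/2, h] are ⌊h/2⌋+1, …, h; the search returns the
-- least one with nonempty D (D_h(p) is always nonempty, so the default
-- value h is never an artificial choice).
muOf : ∀ {n h} → Profile n h → ℕ
muOf {h = h} p = searchMu p (suc (h / 2)) (h Data.Nat.∸ suc (h / 2))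
  where import Data.Nat

T₃ : ℕ → ℕ → Set
T₃ h n = (n ≡ 2) Data.Sum.⊎ ((h ≡ 3) × (n ≡ 3))
  where import Data.Sum

module Submission where

-- Adding a voter together with the reversed voter raises every off-diagonal support by one, and raises
-- the range (h/2, h] of admissible thresholds by one as well; so D_{μ+1} of the padded profile is D_μ(p),
-- and μ(p), μ(pʳ) shift by one. Hence it suffices to realise the property for h = 2 (n ≥ 3), h = 3 (n ≥ 4) and
-- (h, n) = (5, 3), and every other pair outside T₃ follows by padding.
-- For n = 2, x ∈ D_μ(pʳ) exactly when the other alternative lies in D_μ(p); so μ(p) = μ(pʳ), and an
-- alternative in both D's puts both alternatives into D_{μ(p)}(p).
-- For (h, n) = (3, 3), the supports are fixed by three entries in {0, …, 3}; unanimity of u over v forces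
-- every w to beat v at least as often as u, and the 64 resulting tables are checked exhaustively.

open import Defs
open import Data.Nat using (ℕ; _≤_)
open import Data.Fin using (Fin)
open import Data.Product using (Σ; ∃; _×_)
open import Function.Bundles using (_⇔_)
open import Relation.Nullary using (¬_)

open import Data.Empty using (⊥-elim)
open import Data.Fin using (zero; suc; _≟_; toℕ; fromℕ<)
open import Data.Fin.Properties using (toℕ-fromℕ<; toℕ-injective; all?; any?)
open import Data.List using (List; []; _∷_; length; filter; tabulate)
open import Data.List.Properties
  using (length-filter; length-tabulate; filter-≐; filter-none; filter-complete; filter-accept; filter-reject)
open import Data.List.Relation.Unary.All using (All)
open import Data.List.Relation.Unary.All.Properties using (tabulate⁺; tabulate⁻; all-filter)
open import Data.List.Relation.Binary.Sublist.Propositional using (⊆-refl)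
open import Data.List.Relation.Binary.Sublist.Propositional.Properties using (filter⁺; length-mono-≤)
open import Data.Nat using (zero; suc; _<_; _+_; _∸_; z≤n; s≤s; z<s; s<s; s≤s⁻¹; s<s⁻¹; _≤?_; _<?_)
open import Data.Nat.DivMod using (_/_; m/n≡1+[m∸n]/n)
open import Data.Nat.Properties
  using (+-suc; m+n∸n≡m; ∸-monoʳ-≤; n≤1+n; ≤-refl; <⇒≤; <-irrefl; <-trans; <-≤-trans; <-cmp)
  renaming (_≟_ to _≟ℕ_)
open import Data.Product using (_,_)
open import Data.Sum using (_⊎_; inj₁; inj₂)
open import Data.Unit using (tt)
open import Data.Vec using (lookup) renaming (_∷_ to _∷ᵥ_; [] to []ᵥ)
open import Function using (id; _∘_; case_of_; flip)
open import Function.Bundles using (mk⇔; Equivalence)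
open import Level using (0ℓ)
open import Relation.Binary.Core using (Rel)
open import Relation.Binary.Definitions using (Trichotomous; tri<; tri≈; tri>)
open import Relation.Binary.PropositionalEquality
open import Relation.Binary.Structures using (IsStrictTotalOrder)
open import Relation.Nullary using (Dec; yes; no)
open import Relation.Nullary.Decidable using (toWitness; ¬?; _×-dec_; _→-dec_)
open import Relation.Unary using (Pred; Decidable)
open import Relation.Unary.Properties using (∁?)

variable
  n h : ℕ

module _ {A : Set} {P : Pred A 0ℓ} (P? : Decidable P) where

  length-filter-∁ : ∀ xs → length (filter P? xs) + length (filter (∁? P?) xs) ≡ length xs
  length-filter-∁ [] = refl
  length-filter-∁ (x ∷ xs) with P? x
  ... | yes _ = cong suc (length-filter-∁ xs)
  ... | no _ = trans (+-suc _ _) (cong suc (length-filter-∁ xs))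

module _ {A B : Set} {P : Pred A 0ℓ} {Q : Pred B 0ℓ} (P? : Decidable P) (Q? : Decidable Q) where

  length-filter-tabulate-cong : ∀ {m} (f : Fin m → A) (g : Fin m → B) → (∀ i → P (f i) ⇔ Q (g i)) →
                                length (filter P? (tabulate f)) ≡ length (filter Q? (tabulate g))
  length-filter-tabulate-cong {zero} f g P⇔Q = refl
  length-filter-tabulate-cong {suc m} f g P⇔Q with P? (f zero) | Q? (g zero)
  ... | yes _ | yes _ = cong suc (length-filter-tabulate-cong (f ∘ suc) (g ∘ suc) (P⇔Q ∘ suc))
  ... | no _  | no _  = length-filter-tabulate-cong (f ∘ suc) (g ∘ suc) (P⇔Q ∘ suc)
  ... | yes p | no ¬q = ⊥-elim (¬q (Equivalence.to (P⇔Q zero) p))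
  ... | no ¬p | yes q = ⊥-elim (¬p (Equivalence.from (P⇔Q zero) q))

module _ (p : Profile n h) where
  private
    module O (i : Fin h) = IsStrictTotalOrder (LinearOrder.isLinear (p i))

    voters : List (Fin h)
    voters = tabulate id

  support-self : ∀ x → support p x x ≡ 0
  support-self x = cong length (filter-none (λ i → above? p i x x) (tabulate⁺ λ i → O.irrefl i refl))

  support-≤ : ∀ y x → support p y x ≤ h
  support-≤ y x = subst (support p y x ≤_) (length-tabulate id) (length-filter (λ i → above? p i y x) voters)

  support-rev : ∀ y x → support (rev p) y x ≡ support p x y
  support-rev y x = cong length (filter-≐ (λ i → above? (rev p) i y x) (λ i → above? p i x y) (id , id) voters)

  support-mono : ∀ {y x y′ x′} → (∀ i → Above p i y x → Above p i y′ x′) → support p y x ≤ support p y′ x′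
  support-mono f = length-mono-≤ (filter⁺ (λ i → above? p i _ _) (λ i → above? p i _ _) (λ { refl → f _ }) (⊆-refl {x = voters}))

  support-complement : ∀ {y x} → y ≢ x → support p y x + support p x y ≡ h
  support-complement {y} {x} y≢x = begin
    support p y x + support p x y                                       ≡⟨ cong (support p y x +_) (cong length (filter-≐ _ _ (asym , total) voters)) ⟩
    support p y x + length (filter (∁? (λ i → above? p i y x)) voters)  ≡⟨ length-filter-∁ (λ i → above? p i y x) voters ⟩
    length voters                                                        ≡⟨ length-tabulate id ⟩
    h                                                                    ∎
    where
    open ≡-Reasoning
    asym : ∀ {i} → Above p i x y → ¬ Above p i y x
    asym {i} x≻y y≻x = O.irrefl i refl (O.trans i x≻y y≻x)
    total : ∀ {i} → ¬ Above p i y x → Above p i x y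
    total {i} y⊁x with O.compare i y x
    ... | tri< y≻x _ _ = ⊥-elim (y⊁x y≻x)
    ... | tri≈ _ y≡x _ = ⊥-elim (y≢x y≡x)
    ... | tri> _ _ x≻y = x≻y

  support≡h⇒above : ∀ {y x} → support p y x ≡ h → ∀ i → Above p i y x
  support≡h⇒above {y} {x} all =
    tabulate⁻ (subst (All _) (filter-complete P? (trans all (sym (length-tabulate id)))) (all-filter P? voters))
    where
    P? : Decidable (λ i → Above p i y x)
    P? i = above? p i y x

module _ (p : Profile n h) where

  searchMu-yes : ∀ {m} k → ∃ (InD m p) → searchMu p m k ≡ m
  searchMu-yes zero    _ = refl
  searchMu-yes {m} (suc k) D with nonempty? m p
  ... | yes _ = refl
  ... | no ¬D = ⊥-elim (¬D D)

  searchMu-no : ∀ {m} k → ¬ ∃ (InD m p) → searchMu p m (suc k) ≡ searchMu p (suc m) k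
  searchMu-no {m} k ¬D with nonempty? m p
  ... | yes D = ⊥-elim (¬D D)
  ... | no _  = refl

  searchMu-≥ : ∀ m k → m ≤ searchMu p m k
  searchMu-≥ m zero = ≤-refl
  searchMu-≥ m (suc k) with nonempty? m p
  ... | yes _ = ≤-refl
  ... | no _  = <⇒≤ (searchMu-≥ (suc m) k)

-- A search that stops at a nonempty D, not at its default value, is determined by which D_μ are nonempty.
searchMu-shift : ∀ {n′ h′} (p : Profile n h) (q : Profile n′ h′) d →
                 (∀ μ → ∃ (InD (suc μ) p) ⇔ ∃ (InD (d + suc μ) q)) →
                 ∀ m {k k′} → k ≤ k′ → ∃ (InD (searchMu p (suc m) k) p) →
                 searchMu q (d + suc m) k′ ≡ d + searchMu p (suc m) k
searchMu-shift p q d D⇔D m {zero} {k′} _ D = searchMu-yes q k′ (Equivalence.to (D⇔D m) D)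
searchMu-shift p q d D⇔D m {suc k} {suc k′} k≤k′ D with nonempty? (suc m) p | nonempty? (d + suc m) q
... | yes _ | yes _  = refl
... | yes D | no ¬D′ = ⊥-elim (¬D′ (Equivalence.to (D⇔D m) D))
... | no ¬D | yes D′ = ⊥-elim (¬D (Equivalence.from (D⇔D m) D′))
... | no _  | no _   = trans (cong (λ μ → searchMu q μ k′) (sym (+-suc d (suc m))))
                             (searchMu-shift p q d D⇔D (suc m) (s≤s⁻¹ k≤k′) D)

muOf-positive : (p : Profile n h) → 0 < muOf p
muOf-positive {h = h} p = <-≤-trans z<s (searchMu-≥ p (suc (h / 2)) (h ∸ suc (h / 2)))

record Shifted (q : Profile n (2 + h)) (p : Profile n h) : Set where
  field support-suc : ∀ {y x} → y ≢ x → support q y x ≡ suc (support p y x)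

module _ {q : Profile n (2 + h)} {p : Profile n h} (shifted : Shifted q p) where
  open Shifted shifted

  Shifted-rev : Shifted (rev q) (rev p)
  Shifted-rev .Shifted.support-suc {y} {x} y≢x = begin
    support (rev q) y x  ≡⟨ support-rev q y x ⟩
    support q x y        ≡⟨ support-suc (≢-sym y≢x) ⟩
    suc (support p x y)  ≡⟨ cong suc (support-rev p y x) ⟨
    suc (support (rev p) y x) ∎
    where open ≡-Reasoning

  InD-shift⁺ : ∀ {μ x} → InD μ p x → InD (suc μ) q x
  InD-shift⁺ {x = x} D y with y ≟ x
  ... | yes refl = subst (_< _) (sym (support-self q x)) z<s
  ... | no y≢x   = subst (_< _) (sym (support-suc y≢x)) (s<s (D y))

  InD-shift⁻ : ∀ {μ x} → 0 < μ → InD (suc μ) q x → InD μ p x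
  InD-shift⁻ {x = x} 0<μ D y with y ≟ x
  ... | yes refl = subst (_< _) (sym (support-self p x)) 0<μ
  ... | no y≢x   = s<s⁻¹ (subst (_< _) (support-suc y≢x) (D y))

  -- The range of q is (h/2 + 1, h + 2], one level longer than the shifted range of p.
  muOf-shift : ∃ (InD (muOf p) p) → muOf q ≡ suc (muOf p)
  muOf-shift D = begin
    muOf q                                                       ≡⟨ cong (λ m → searchMu q (suc m) (2 + h ∸ suc m)) half-2+h ⟩
    searchMu q (suc (suc (h / 2))) (h ∸ h / 2)                   ≡⟨ searchMu-shift p q 1 D⇔D (h / 2) (∸-monoʳ-≤ h (n≤1+n (h / 2))) D ⟩
    suc (muOf p)                                                 ∎
    where
    open ≡-Reasoning
    half-2+h : (2 + h) / 2 ≡ suc (h / 2)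
    half-2+h = m/n≡1+[m∸n]/n {2 + h} (s≤s (s≤s z≤n))
    D⇔D : ∀ μ → ∃ (InD (suc μ) p) ⇔ ∃ (InD (suc (suc μ)) q)
    D⇔D μ = mk⇔ (λ (x , D) → x , InD-shift⁺ D) (λ (x , D) → x , InD-shift⁻ z<s D)

  InD-muOf-shift : ∀ {x} → InD (muOf p) p x → InD (muOf q) q x
  InD-muOf-shift D = subst (λ μ → InD μ q _) (sym (muOf-shift (_ , D))) (InD-shift⁺ D)

  InD-muOf-shift⁻ : ∃ (InD (muOf p) p) → ∀ {x} → InD (muOf q) q x → InD (muOf p) p x
  InD-muOf-shift⁻ D {x} D′ = InD-shift⁻ (muOf-positive p) (subst (λ μ → InD μ q x) (muOf-shift D) D′)

module _ (key : Fin n → ℕ) where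

  KeyOrder : Rel (Fin n) 0ℓ
  KeyOrder x y = key x < key y ⊎ (key x ≡ key y × toℕ x < toℕ y)

  private
    irrefl : ∀ {x y} → x ≡ y → ¬ KeyOrder x y
    irrefl refl (inj₁ k<k) = <-irrefl refl k<k
    irrefl refl (inj₂ (_ , i<i)) = <-irrefl refl i<i

    trans′ : ∀ {x y z} → KeyOrder x y → KeyOrder y z → KeyOrder x z
    trans′ (inj₁ a) (inj₁ b) = inj₁ (<-trans a b)
    trans′ {x} (inj₁ a) (inj₂ (e , _)) = inj₁ (subst (key x <_) e a)
    trans′ {z = z} (inj₂ (e , _)) (inj₁ b) = inj₁ (subst (_< key z) (sym e) b)
    trans′ (inj₂ (e , a)) (inj₂ (e′ , b)) = inj₂ (trans e e′ , <-trans a b)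

    compare : Trichotomous _≡_ KeyOrder
    compare x y with <-cmp (key x) (key y)
    ... | tri< a ¬b ¬c = tri< (inj₁ a) (¬b ∘ cong key) λ { (inj₁ c) → ¬c c ; (inj₂ (e , _)) → ¬b (sym e) }
    ... | tri> ¬a ¬b c = tri> (λ { (inj₁ a) → ¬a a ; (inj₂ (e , _)) → ¬b e }) (¬b ∘ cong key) (inj₁ c)
    ... | tri≈ ¬a b ¬c with <-cmp (toℕ x) (toℕ y)
    ...   | tri< a′ ¬b′ ¬c′ = tri< (inj₂ (b , a′)) (¬b′ ∘ cong toℕ) λ { (inj₁ c) → ¬c c ; (inj₂ (_ , c)) → ¬c′ c }
    ...   | tri≈ ¬a′ b′ ¬c′ = tri≈ (λ { (inj₁ a) → ¬a a ; (inj₂ (_ , a)) → ¬a′ a }) (toℕ-injective b′) λ { (inj₁ c) → ¬c c ; (inj₂ (_ , c)) → ¬c′ c }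
    ...   | tri> ¬a′ ¬b′ c′ = tri> (λ { (inj₁ a) → ¬a a ; (inj₂ (_ , a)) → ¬a′ a }) (¬b′ ∘ cong toℕ) (inj₂ (sym b , c′))

  byKey : LinearOrder n
  byKey = record
    { _≻_ = KeyOrder
    ; isLinear = record
      { isStrictPartialOrder = record
        { isEquivalence = isEquivalence ; irrefl = irrefl ; trans = trans′ ; <-resp-≈ = resp₂ KeyOrder }
      ; compare = compare
      }
    }

pad : LinearOrder n → Profile n h → Profile n (2 + h)
pad A p zero          = A
pad A p (suc zero)    = reverseOrder A
pad A p (suc (suc i)) = p i

module _ (A : LinearOrder n) (p : Profile n h) {y x : Fin n} where
  private
    module A = IsStrictTotalOrder (LinearOrder.isLinear A)
    open LinearOrder A renaming (_≻_ to _≻A_)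

    votes : Decidable (λ i → Above (pad A p) i y x)
    votes i = above? (pad A p) i y x

    rest : List (Fin (2 + h))
    rest = tabulate (λ i → suc (suc i))

    later-voters : length (filter votes rest) ≡ support p y x
    later-voters = length-filter-tabulate-cong votes (λ i → above? p i y x) (λ i → suc (suc i)) id (λ _ → mk⇔ id id)

    counted-by-first : y ≻A x → ¬ x ≻A y → support (pad A p) y x ≡ suc (support p y x)
    counted-by-first y≻x x⊁y = begin
      length (filter votes (zero ∷ suc zero ∷ rest))  ≡⟨ cong length (filter-accept votes {x = zero} {xs = suc zero ∷ rest} y≻x) ⟩
      suc (length (filter votes (suc zero ∷ rest)))   ≡⟨ cong (suc ∘ length) (filter-reject votes {x = suc zero} {xs = rest} x⊁y) ⟩
      suc (length (filter votes rest))                ≡⟨ cong suc later-voters ⟩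
      suc (support p y x)                             ∎
      where open ≡-Reasoning

    counted-by-second : ¬ y ≻A x → x ≻A y → support (pad A p) y x ≡ suc (support p y x)
    counted-by-second y⊁x x≻y = begin
      length (filter votes (zero ∷ suc zero ∷ rest))  ≡⟨ cong length (filter-reject votes {x = zero} {xs = suc zero ∷ rest} y⊁x) ⟩
      length (filter votes (suc zero ∷ rest))         ≡⟨ cong length (filter-accept votes {x = suc zero} {xs = rest} x≻y) ⟩
      suc (length (filter votes rest))                ≡⟨ cong suc later-voters ⟩
      suc (support p y x)                             ∎
      where open ≡-Reasoning

  pad-support-suc : y ≢ x → support (pad A p) y x ≡ suc (support p y x)
  pad-support-suc y≢x = case A.compare y x of λ where
    (tri< y≻x _ x⊁y) → counted-by-first y≻x x⊁y
    (tri≈ _ y≡x _)   → ⊥-elim (y≢x y≡x)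
    (tri> y⊁x _ x≻y) → counted-by-second y⊁x x≻y

pad-shifted : (A : LinearOrder n) (p : Profile n h) → Shifted (pad A p) p
pad-shifted A p = record { support-suc = pad-support-suc A p }

Achievable : ℕ → ℕ → Set₁
Achievable n h = Σ (Profile n h) λ p →
  (¬ (∀ x → InD (muOf p) p x)) × (∃ λ x → InD (muOf p) p x × InD (muOf (rev p)) (rev p) x)

Achievable-pad : Achievable n h → Achievable n (2 + h)
Achievable-pad {n} (p , D≠N , x , D , Dʳ) =
  q , D′≠N , x , InD-muOf-shift shifted D , InD-muOf-shift (Shifted-rev shifted) Dʳ
  where
  q : Profile n _
  q = pad (byKey toℕ) p
  shifted : Shifted q p
  shifted = pad-shifted (byKey toℕ) p
  D′≠N : ¬ (∀ z → InD (muOf q) q z)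
  D′≠N all = D≠N λ z → InD-muOf-shift⁻ shifted (x , D) (all z)

module _ {n : ℕ} where

  -- Voter 1 ranks by index, voter 2 moves 0 to the bottom: 1 beats 2 unanimously, while 0 is neither
  -- unanimously beaten nor unanimously beating.
  bottomMoved : Profile (3 + n) 2
  bottomMoved zero       = byKey (λ _ → 0)
  bottomMoved (suc zero) = byKey λ { zero → 1 ; (suc _) → 0 }

  achievable-h2 : Achievable (3 + n) 2
  achievable-h2 = bottomMoved , (λ all → <-irrefl refl (all (suc (suc zero)) (suc zero))) , zero
                , (λ { zero → z<s ; (suc _) → s<s z<s })
                , (λ { zero → z<s ; (suc _) → s<s z<s })

  -- 0 beats everyone 2 to 1; among the others 1 > 2 > 3 > 1 and every j ≥ 3 beats 1, so there is no Condorcet loser.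
  winnerOverCycle : Profile (4 + n) 3
  winnerOverCycle zero             = byKey (λ _ → 0)
  winnerOverCycle (suc zero)       = byKey λ { (suc zero) → 1 ; _ → 0 }
  winnerOverCycle (suc (suc zero)) = byKey λ { zero → 3 ; (suc zero) → 1 ; (suc (suc zero)) → 2 ; _ → 0 }

  private
    p = winnerOverCycle

    winner : InD 2 p zero
    winner zero                = z<s
    winner (suc zero)          = s<s z<s
    winner (suc (suc zero))    = s<s z<s
    winner (suc (suc (suc _))) = s<s z<s

    winnerʳ : InD 3 (rev p) zero
    winnerʳ zero                = z<s
    winnerʳ (suc zero)          = ≤-refl
    winnerʳ (suc (suc zero))    = ≤-refl
    winnerʳ (suc (suc (suc _))) = ≤-refl

    beats-some : ∀ z → ∃ λ y → 2 ≤ support p z y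
    beats-some zero                = suc zero , ≤-refl
    beats-some (suc zero)          = suc (suc zero) , ≤-refl
    beats-some (suc (suc zero))    = suc (suc (suc zero)) , ≤-refl
    beats-some (suc (suc (suc _))) = suc zero , ≤-refl

    no-winnerʳ : ¬ ∃ (InD 2 (rev p))
    no-winnerʳ (z , D) = let (y , 2≤) = beats-some z in
      <-irrefl refl (<-≤-trans (subst (_< 2) (support-rev p y z) (D y)) 2≤)

    μ≡2 : muOf p ≡ 2
    μ≡2 = searchMu-yes p 1 (zero , winner)

    μʳ≡3 : muOf (rev p) ≡ 3
    μʳ≡3 = searchMu-no (rev p) 0 no-winnerʳ

  achievable-h3 : Achievable (4 + n) 3
  achievable-h3 = p , (λ all → <-irrefl refl (subst (support p zero (suc zero) <_) μ≡2 (all (suc zero) zero))) , zero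
                , subst (λ μ → InD μ p zero) (sym μ≡2) winner , subst (λ μ → InD μ (rev p) zero) (sym μʳ≡3) winnerʳ

-- The majority cycle 0 → 1 → 2 → 0 has supports 3, 4, 3, so μ = 4 for this profile and for its reverse,
-- and 0 lies in both D₄.
cyclic : Profile 3 5
cyclic zero                = byKey (lookup (0 ∷ᵥ 1 ∷ᵥ 2 ∷ᵥ []ᵥ))
cyclic (suc zero)          = byKey (lookup (0 ∷ᵥ 1 ∷ᵥ 2 ∷ᵥ []ᵥ))
cyclic (suc (suc zero))    = byKey (lookup (1 ∷ᵥ 2 ∷ᵥ 0 ∷ᵥ []ᵥ))
cyclic (suc (suc (suc _))) = byKey (lookup (2 ∷ᵥ 0 ∷ᵥ 1 ∷ᵥ []ᵥ))

achievable-n3-h5 : Achievable 3 5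
achievable-n3-h5 = cyclic , toWitness {a? = ¬? (all? (InD? _ cyclic)) ×-dec any? λ x → InD? _ cyclic x ×-dec InD? _ (rev cyclic) x} tt

achievable : ∀ n h → 2 ≤ n → 2 ≤ h → ¬ T₃ h n → Achievable n h
achievable 1 _ (s≤s ()) _ _
achievable 2 _ _ _ ¬T = ⊥-elim (¬T (inj₁ refl))
achievable (suc (suc (suc n))) 1 _ (s≤s ()) _
achievable (suc (suc (suc n))) 2 _ _ _ = achievable-h2
achievable 3 3 _ _ ¬T = ⊥-elim (¬T (inj₂ (refl , refl)))
achievable (suc (suc (suc (suc n)))) 3 _ _ _ = achievable-h3
achievable 3 4 _ _ _ = Achievable-pad achievable-h2
achievable 3 5 _ _ _ = achievable-n3-h5
achievable 3 (suc (suc (suc (suc (suc (suc h)))))) _ _ _ =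
  Achievable-pad (achievable 3 (suc (suc (suc (suc h)))) (s≤s (s≤s z≤n)) (s≤s (s≤s z≤n)) λ { (inj₁ ()) ; (inj₂ (() , _)) })
achievable (suc (suc (suc (suc n)))) (suc (suc (suc (suc h)))) _ _ _ =
  Achievable-pad (achievable (suc (suc (suc (suc n)))) (suc (suc h)) (s≤s (s≤s z≤n)) (s≤s (s≤s z≤n)) λ { (inj₁ ()) ; (inj₂ (_ , ())) })

other : Fin 2 → Fin 2
other zero       = suc zero
other (suc zero) = zero

other-or-self : ∀ x y → y ≡ x ⊎ y ≡ other x
other-or-self zero       zero       = inj₁ refl
other-or-self zero       (suc zero) = inj₂ refl
other-or-self (suc zero) zero       = inj₂ refl
other-or-self (suc zero) (suc zero) = inj₁ refl

module _ {h′} (p : Profile 2 h) (q : Profile 2 h′) (mirror : ∀ y x → support q y x ≡ support p x y) where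

  InD-mirror : ∀ {μ x} → 0 < μ → InD μ q x → InD μ p (other x)
  InD-mirror {μ} {x} 0<μ D y = case other-or-self x y of λ where
    (inj₁ refl) → subst (_< μ) (mirror (other x) x) (D (other x))
    (inj₂ refl) → subst (_< μ) (sym (support-self p y)) 0<μ

unachievable-n2 : ¬ Achievable 2 h
unachievable-n2 {h} (p , D≠N , x , D , Dʳ) = D≠N everyone
  where
  D⇔Dʳ : ∀ μ → ∃ (InD (suc μ) p) ⇔ ∃ (InD (suc μ) (rev p))
  D⇔Dʳ μ = mk⇔ (λ (y , Dy) → other y , InD-mirror (rev p) p (λ y x → sym (support-rev p x y)) z<s Dy)
               (λ (y , Dy) → other y , InD-mirror p (rev p) (support-rev p) z<s Dy)
  μʳ≡μ : muOf (rev p) ≡ muOf p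
  μʳ≡μ = searchMu-shift p (rev p) 0 D⇔Dʳ (h / 2) {h ∸ suc (h / 2)} ≤-refl (x , D)
  everyone : ∀ y → InD (muOf p) p y
  everyone y = case other-or-self x y of λ where
    (inj₁ refl) → D
    (inj₂ refl) → InD-mirror p (rev p) (support-rev p) (muOf-positive p) (subst (λ μ → InD μ (rev p) x) μʳ≡μ Dʳ)

Tally : ℕ → Set
Tally n = Fin n → Fin n → ℕ

-- InD μ p is Unbeaten μ (support p) by definition, so D and μ for three voters can be decided on tallies.
Unbeaten : ℕ → Tally n → Fin n → Set
Unbeaten μ S x = ∀ y → S y x < μ

Unbeaten? : ∀ μ (S : Tally n) x → Dec (Unbeaten μ S x)
Unbeaten? μ S x = all? λ y → S y x <? μ

μ₃ : Tally n → ℕ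
μ₃ S with any? (Unbeaten? 2 S)
... | yes _ = 2
... | no _  = 3

muOf-three : (p : Profile n 3) → muOf p ≡ μ₃ (support p)
muOf-three p with nonempty? 2 p
... | yes _ = refl
... | no _  = refl

μ₃-cong : {S S′ : Tally n} → (∀ y x → S y x ≡ S′ y x) → μ₃ S ≡ μ₃ S′
μ₃-cong {S = S} {S′} S≡S′ with any? (Unbeaten? 2 S) | any? (Unbeaten? 2 S′)
... | yes _       | yes _       = refl
... | no _        | no _        = refl
... | yes (x , D) | no ¬D′      = ⊥-elim (¬D′ (x , λ y → subst (_< 2) (S≡S′ y x) (D y)))
... | no ¬D       | yes (x , D′) = ⊥-elim (¬D (x , λ y → subst (_< 2) (sym (S≡S′ y x)) (D′ y)))

AchievableTally : Tally n → Tally n → Set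
AchievableTally S R = (¬ (∀ x → Unbeaten (μ₃ S) S x)) × (∃ λ x → Unbeaten (μ₃ S) S x × Unbeaten (μ₃ R) R x)

AchievableTally? : (S R : Tally n) → Dec (AchievableTally S R)
AchievableTally? S R = ¬? (all? (Unbeaten? (μ₃ S) S)) ×-dec any? λ x → Unbeaten? (μ₃ S) S x ×-dec Unbeaten? (μ₃ R) R x

AchievableTally-cong : {S S′ R R′ : Tally n} → (∀ y x → S y x ≡ S′ y x) → (∀ y x → R y x ≡ R′ y x) →
                       AchievableTally S R → AchievableTally S′ R′
AchievableTally-cong {S = S} {S′} {R} {R′} S≡S′ R≡R′ (D≠N , x , D , Dʳ) =
  (λ all → D≠N λ z → transport (λ y x → sym (S≡S′ y x)) (all z)) , x , transport S≡S′ D , transport R≡R′ Dʳ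
  where
  transport : {T T′ : Tally n} → (∀ y x → T y x ≡ T′ y x) → ∀ {x} → Unbeaten (μ₃ T) T x → Unbeaten (μ₃ T′) T′ x
  transport T≡T′ {x} D y = subst₂ _<_ (T≡T′ y x) (μ₃-cong T≡T′) (D y)

-- a, b and c are the supports of 0 over 1, 1 over 2 and 2 over 0; the reversed pairs get their complements to 3.
tally₃ : ℕ → ℕ → ℕ → Tally 3
tally₃ a b c zero             (suc zero)       = a
tally₃ a b c (suc zero)       (suc (suc zero)) = b
tally₃ a b c (suc (suc zero)) zero             = c
tally₃ a b c (suc zero)       zero             = 3 ∸ a
tally₃ a b c (suc (suc zero)) (suc zero)       = 3 ∸ b
tally₃ a b c zero             (suc (suc zero)) = 3 ∸ c
tally₃ a b c _                _                = 0

UnanimityClosed : Tally n → Set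
UnanimityClosed S = ∀ u v w → S u v ≡ 3 → S w u ≤ S w v

UnanimityClosed? : (S : Tally n) → Dec (UnanimityClosed S)
UnanimityClosed? S = all? λ u → all? λ v → all? λ w → (S u v ≟ℕ 3) →-dec (S w u ≤? S w v)

no-achievable-tally₃ : ∀ (a b c : Fin 4) → let S = tally₃ (toℕ a) (toℕ b) (toℕ c) in
                       UnanimityClosed S → ¬ AchievableTally S (flip S)
no-achievable-tally₃ = toWitness {a? = all? λ a → all? λ b → all? λ c → UnanimityClosed? _ →-dec ¬? (AchievableTally? _ _)} tt

unachievable-n3-h3 : ¬ Achievable 3 3
unachievable-n3-h3 (p , D≠N , x , D , Dʳ) =
  no-achievable-tally₃ a b c closed (AchievableTally-cong support≡tally supportʳ≡tally tally-achievable)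
  where
  entry : Fin 3 → Fin 3 → Fin 4
  entry y x = fromℕ< (s≤s (support-≤ p y x))
  a b c : Fin 4
  a = entry zero (suc zero)
  b = entry (suc zero) (suc (suc zero))
  c = entry (suc (suc zero)) zero
  S : Tally 3
  S = tally₃ (toℕ a) (toℕ b) (toℕ c)

  entry≡ : ∀ y x → support p y x ≡ toℕ (entry y x)
  entry≡ y x = sym (toℕ-fromℕ< (s≤s (support-≤ p y x)))
  complement : ∀ y x → y ≢ x → support p y x ≡ 3 ∸ toℕ (entry x y)
  complement y x y≢x = begin
    support p y x                               ≡⟨ m+n∸n≡m (support p y x) (support p x y) ⟨
    support p y x + support p x y ∸ support p x y ≡⟨ cong₂ _∸_ (support-complement p y≢x) (entry≡ x y) ⟩
    3 ∸ toℕ (entry x y)                         ∎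
    where open ≡-Reasoning

  support≡tally : ∀ y x → support p y x ≡ S y x
  support≡tally zero             zero             = support-self p zero
  support≡tally (suc zero)       (suc zero)       = support-self p (suc zero)
  support≡tally (suc (suc zero)) (suc (suc zero)) = support-self p (suc (suc zero))
  support≡tally zero             (suc zero)       = entry≡ _ _
  support≡tally (suc zero)       (suc (suc zero)) = entry≡ _ _
  support≡tally (suc (suc zero)) zero             = entry≡ _ _
  support≡tally (suc zero)       zero             = complement _ _ λ ()
  support≡tally (suc (suc zero)) (suc zero)       = complement _ _ λ ()
  support≡tally zero             (suc (suc zero)) = complement _ _ λ ()

  supportʳ≡tally : ∀ y x → support (rev p) y x ≡ flip S y x
  supportʳ≡tally y x = trans (support-rev p y x) (support≡tally x y)

  closed : UnanimityClosed S
  closed u v w Suv≡3 = subst₂ _≤_ (support≡tally w u) (support≡tally w v)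
    (support-mono p λ i w≻u → O.trans i w≻u (support≡h⇒above p (trans (support≡tally u v) Suv≡3) i))
    where module O (i : Fin 3) = IsStrictTotalOrder (LinearOrder.isLinear (p i))

  tally-achievable : AchievableTally (support p) (support (rev p))
  tally-achievable = (λ all → D≠N λ z → subst (λ μ → InD μ p z) (sym (muOf-three p)) (all z))
             , x , subst (λ μ → InD μ p x) (muOf-three p) D , subst (λ μ → InD μ (rev p) x) (muOf-three (rev p)) Dʳ

proposition8 : (n h : ℕ) → 2 ≤ n → 2 ≤ h →
    (Σ (Profile n h) (λ p →
        (¬ (∀ x → InD (muOf p) p x))
        × (∃ λ x → InD (muOf p) p x × InD (muOf (rev p)) (rev p) x)))
    ⇔ (¬ T₃ h n)
proposition8 n h 2≤n 2≤h = mk⇔ (λ achieved → λ { (inj₁ refl) → unachievable-n2 achieved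
                                              ; (inj₂ (refl , refl)) → unachievable-n3-h3 achieved })
                                (achievable n h 2≤n 2≤h)
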